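{- Let $(\partial:C_1\to C_0,\ \partial^t:C_0\to C_1)$ and $(\partial':C_1'\to C_0',\ (\partial')^t:C_0'\to C_1')$ be adjoint pairs, with $Z=\ker\partial$, $B=\operatorname{im}\partial^t$, $Z'=\ker\partial'$, $B'=\operatorname{im}(\partial')^t$. Suppose $f_1:C_1\to C_1'$ is a $\mathbf{Z}$-linear map with $f_1(Z)\subset Z'$ and $f_1(B)\subset B'$. Define $f_0:\operatorname{im}\partial\to C_0'$ by $f_0(\partial x):=\partial' f_1(x)$. Then $f_0$ is well defined and $f=(f_1,f_0)$ is a morphism from the pair $(\partial:C_1\to\operatorname{im}\partial,\ \partial^t|_{\operatorname{im}\partial}:\operatorname{im}\partial\to C_1)$ to $(\partial',(\partial')^t)$; that is, $f_0\partial=\partial' f_1$ and $f_1\partial^t(y)\equiv(\partial')^t f_0(y)\pmod{B'}$ for all $y\in\operatorname{im}\partial$.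
   Context: An adjoint pair consists of finitely generated free $\mathbf{Z}$-modules $C_1$, $C_0$, each with a positive definite inner product $\langle-,-\rangle$ and an orthonormal basis, together with $\mathbf{Z}$-linear maps $\partial:C_1\to C_0$ and $\partial^t:C_0\to C_1$ satisfying $\langle\partial e,v\rangle=\langle e,\partial^t v\rangle$ for all $e\in C_1$, $v\in C_0$. A morphism from $(\partial,\partial^t)$ to $(\partial',(\partial')^t)$ is a pair of linear maps $(f_1:C_1\to C_1',\ f_0:C_0\to C_0')$ with $f_0\partial=\partial' f_1$ and $f_1\partial^t\equiv(\partial')^t f_0\pmod{B'}$. -}

module Defs where

open import Data.Nat using (ℕ; zero; suc)
open import Data.Fin using (Fin; zero; suc)
open import Data.Integer using (ℤ; _+_; _*_; _-_; 0ℤ)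
open import Data.Product using (Σ; ∃; _×_; _,_; proj₁)
open import Relation.Binary.PropositionalEquality using (_≡_)

-- A free ℤ-module of rank n with orthonormal basis is identified with ℤⁿ
-- (vectors Fin n → ℤ) with the standard inner product.
Vec : ℕ → Set
Vec n = Fin n → ℤ

∑ : (n : ℕ) → (Fin n → ℤ) → ℤ
∑ zero    f = 0ℤ
∑ (suc n) f = f zero + ∑ n (λ i → f (suc i))

⟨_,_⟩ : {n : ℕ} → Vec n → Vec n → ℤ
⟨_,_⟩ {n} u v = ∑ n (λ i → u i * v i)

-- ℤ-linear maps ℤᵐ → ℤⁿ, given by their matrices w.r.t. the bases
Lin : ℕ → ℕ → Set
Lin m n = Fin n → Fin m → ℤ

apply : {m n : ℕ} → Lin m n → Vec m → Vec n
apply {m} A x i = ∑ m (λ j → A i j * x j)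

_≈_ : {n : ℕ} → Vec n → Vec n → Set
u ≈ v = ∀ i → u i ≡ v i

_-ᵥ_ : {n : ℕ} → Vec n → Vec n → Vec n
(u -ᵥ v) i = u i - v i

zeroᵥ : {n : ℕ} → Vec n
zeroᵥ i = 0ℤ

record AdjointPair (m n : ℕ) : Set where
  field
    ∂  : Lin m n
    ∂ᵗ : Lin n m
    adjoint : ∀ (e : Vec m) (v : Vec n) → ⟨ apply ∂ e , v ⟩ ≡ ⟨ e , apply ∂ᵗ v ⟩

open AdjointPair public

_∈Ker_ : {m n : ℕ} → Vec m → Lin m n → Set
x ∈Ker A = apply A x ≈ zeroᵥ

_∈Im_ : {m n : ℕ} → Vec n → Lin m n → Set
y ∈Im A = ∃ λ x → apply A x ≈ y

Im : {m n : ℕ} → Lin m n → Set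
Im {m} {n} A = Σ (Vec n) (λ y → y ∈Im A)

-- f₀ : im ∂ → C₀' defined by f₀(∂x) := ∂'(f₁ x), via the chosen preimage
f₀ : {m n m' n' : ℕ} (P : AdjointPair m n) (P' : AdjointPair m' n')
     (f₁ : Lin m m') → Im (∂ P) → Vec n'
f₀ P P' f₁ (y , x , _) = apply (∂ P') (apply f₁ x)

_≡_mod_ : {m n : ℕ} → Vec m → Vec m → Lin n m → Set
u ≡ v mod A = (u -ᵥ v) ∈Im A

-- Two preimages of the same y ∈ im ∂ differ by an element of Z, which f₁
-- sends into Z' = ker ∂', so f₀ is well defined; f₀ ∂ = ∂' f₁ is then its
-- definition. The congruence holds because both sides already lie in B':
-- f₁ ∂ᵗ y ∈ f₁(B) ⊂ B', and (∂')ᵗ f₀ y ∈ im (∂')ᵗ = B'.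
module Submission where

open import Defs
open import Data.Nat using (ℕ; zero; suc)
open import Data.Fin using (Fin; zero; suc)
open import Data.Integer using (ℤ; _+_; _*_; _-_)
open import Data.Integer.Properties using (i-j≡0⇒i≡j; i≡j⇒i-j≡0)
open import Data.Integer.Solver using (module +-*-Solver)
open import Data.Product using (_×_; _,_; proj₁)
open import Relation.Binary.PropositionalEquality

open +-*-Solver

∑-cong : ∀ n {f g : Fin n → ℤ} → (∀ i → f i ≡ g i) → ∑ n f ≡ ∑ n g
∑-cong zero    f≡g = refl
∑-cong (suc n) f≡g = cong₂ _+_ (f≡g zero) (∑-cong n (λ i → f≡g (suc i)))

∑-sub : ∀ n (f g : Fin n → ℤ) → ∑ n (λ j → f j - g j) ≡ ∑ n f - ∑ n g
∑-sub zero    f g = refl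
∑-sub (suc n) f g = begin
  (f zero - g zero) + ∑ n (λ j → f (suc j) - g (suc j))
    ≡⟨ cong ((f zero - g zero) +_) (∑-sub n _ _) ⟩
  (f zero - g zero) + (∑ n (f ∘suc) - ∑ n (g ∘suc))
    ≡⟨ solve 4 (λ a b c d → (a :- b) :+ (c :- d) := (a :+ c) :- (b :+ d)) refl
         (f zero) (g zero) (∑ n (f ∘suc)) (∑ n (g ∘suc)) ⟩
  (f zero + ∑ n (f ∘suc)) - (g zero + ∑ n (g ∘suc)) ∎
  where
  open ≡-Reasoning
  _∘suc : (Fin (suc n) → ℤ) → Fin n → ℤ
  h ∘suc = λ j → h (suc j)

apply-cong : ∀ {m n} (A : Lin m n) {u v : Vec m} → u ≈ v → apply A u ≈ apply A v
apply-cong {m} A u≈v i = ∑-cong m (λ j → cong (A i j *_) (u≈v j))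

apply-sub : ∀ {m n} (A : Lin m n) (u v : Vec m) →
            apply A (u -ᵥ v) ≈ (apply A u -ᵥ apply A v)
apply-sub {m} A u v i = trans
  (∑-cong m (λ j → solve 3 (λ a b c → a :* (b :- c) := a :* b :- a :* c) refl
                      (A i j) (u j) (v j)))
  (∑-sub m _ _)

∈Ker-resp-≈ : ∀ {m n} (A : Lin m n) {u v : Vec m} → u ≈ v → u ∈Ker A → v ∈Ker A
∈Ker-resp-≈ A u≈v u∈Ker i = trans (sym (apply-cong A u≈v i)) (u∈Ker i)

sameImage⇒-ᵥ∈Ker : ∀ {m n} (A : Lin m n) {u v : Vec m} →
                    apply A u ≈ apply A v → (u -ᵥ v) ∈Ker A
sameImage⇒-ᵥ∈Ker A {u} {v} Au≈Av i =
  trans (apply-sub A u v i) (i≡j⇒i-j≡0 (Au≈Av i))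

-ᵥ∈Ker⇒sameImage : ∀ {m n} (A : Lin m n) {u v : Vec m} →
                    (u -ᵥ v) ∈Ker A → apply A u ≈ apply A v
-ᵥ∈Ker⇒sameImage A {u} {v} u-v∈Ker i =
  i-j≡0⇒i≡j _ _ (trans (sym (apply-sub A u v i)) (u-v∈Ker i))

apply∈Im : ∀ {m n} (A : Lin m n) (x : Vec m) → apply A x ∈Im A
apply∈Im A x = x , λ i → refl

-ᵥ-∈Im : ∀ {m n} (A : Lin m n) {u v : Vec n} → u ∈Im A → v ∈Im A → (u -ᵥ v) ∈Im A
-ᵥ-∈Im A (x , Ax≈u) (x' , Ax'≈v) =
  (x -ᵥ x') , λ i → trans (apply-sub A x x' i) (cong₂ _-_ (Ax≈u i) (Ax'≈v i))

module _ {m n m' n' : ℕ} (P : AdjointPair m n) (P' : AdjointPair m' n')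
         (f₁ : Lin m m') where

  f₀-wellDefined : (∀ (x : Vec m) → x ∈Ker ∂ P → apply f₁ x ∈Ker ∂ P') →
                   (p q : Im (∂ P)) → proj₁ p ≈ proj₁ q →
                   f₀ P P' f₁ p ≈ f₀ P P' f₁ q
  f₀-wellDefined f₁Z⊆Z' (y , x , ∂x≈y) (y' , x' , ∂x'≈y') y≈y' =
    -ᵥ∈Ker⇒sameImage (∂ P') f₁x-f₁x'∈Z'
    where
    x-x'∈Z : (x -ᵥ x') ∈Ker ∂ P
    x-x'∈Z = sameImage⇒-ᵥ∈Ker (∂ P) λ i →
      trans (∂x≈y i) (trans (y≈y' i) (sym (∂x'≈y' i)))
    f₁x-f₁x'∈Z' : (apply f₁ x -ᵥ apply f₁ x') ∈Ker ∂ P'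
    f₁x-f₁x'∈Z' = ∈Ker-resp-≈ (∂ P') (apply-sub f₁ x x') (f₁Z⊆Z' _ x-x'∈Z)

  f₁∂ᵗ≡∂'ᵗf₀-mod-B' : (∀ (b : Vec m) → b ∈Im ∂ᵗ P → apply f₁ b ∈Im ∂ᵗ P') →
                      (p : Im (∂ P)) →
                      apply f₁ (apply (∂ᵗ P) (proj₁ p))
                        ≡ apply (∂ᵗ P') (f₀ P P' f₁ p) mod ∂ᵗ P'
  f₁∂ᵗ≡∂'ᵗf₀-mod-B' f₁B⊆B' (y , _) =
    -ᵥ-∈Im (∂ᵗ P') (f₁B⊆B' _ (apply∈Im (∂ᵗ P) y)) (apply∈Im (∂ᵗ P') _)

mainTheorem11 : {m n m' n' : ℕ} (P : AdjointPair m n) (P' : AdjointPair m' n')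
    (f₁ : Lin m m') →
    (∀ (x : Vec m) → x ∈Ker ∂ P → apply f₁ x ∈Ker ∂ P') →
    (∀ (b : Vec m) → b ∈Im ∂ᵗ P → apply f₁ b ∈Im ∂ᵗ P') →
    ((p q : Im (∂ P)) → proj₁ p ≈ proj₁ q → f₀ P P' f₁ p ≈ f₀ P P' f₁ q)
    × (∀ (x : Vec m) (y : Vec n) (e : apply (∂ P) x ≈ y) →
         f₀ P P' f₁ (y , x , e) ≈ apply (∂ P') (apply f₁ x))
    × ((p : Im (∂ P)) →
         apply f₁ (apply (∂ᵗ P) (proj₁ p)) ≡ apply (∂ᵗ P') (f₀ P P' f₁ p) mod ∂ᵗ P')
mainTheorem11 P P' f₁ f₁Z⊆Z' f₁B⊆B' =
    f₀-wellDefined P P' f₁ f₁Z⊆Z'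
  , (λ x y e i → refl)
  , f₁∂ᵗ≡∂'ᵗf₀-mod-B' P P' f₁ f₁B⊆B'
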